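{- Let $n\geq 3$, $s\geq 1$ and $r\geq 2$ be integers, let $G$ be an even carousel or an odd carousel of order $s$ on $n$ sets $X_1,\dots,X_n$, and let $(Y,Z)$ be a partition of $V(G)$ with $\mathrm{rk}_G(Y,Z)<r$. Let $m\geq 0$, $1\le i<n$ and $1\le j\le s$ be integers. (1) Suppose $(G,X_i,X_{i+1})$ is a regular parallel triple. If $X_{i,j}$ has label $Y_m$, then $X_{i+1,j}$ has label $Y_{\max(m-1,0)}$, $Y_m$ or $Y_{m+1}$. If $\overline{X}_{i,j}$ has label $Y_m$, then $\overline{X}_{i+1,j}$ has label $Y_{\max(m-1,0)}$, $Y_m$ or $Y_{m+1}$. (2) Suppose $(G,X_i,X_{i+1})$ is a regular cross triple. If $X_{i,j}$ has label $Y_m$, then $\overline{X}_{i+1,j}$ has label $Y_{\max(m-1,0)}$, $Y_m$ or $Y_{m+1}$. If $\overline{X}_{i,j}$ has label $Y_m$, then $X_{i+1,j}$ has label $Y_{\max(m-1,0)}$, $Y_m$ or $Y_{m+1}$.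
   Context: All graphs are finite and simple. Let $X=\{u^1,\dots,u^k\}$ and $X'=\{v^1,\dots,v^k\}$ be two disjoint ordered sets of $k$ vertices of a graph $G$. The triple $(G,X,X')$ is called: - a regular matching if for all $j,j'\in\{1,\dots,k\}$: $u^jv^{j'}\in E(G)$ iff $j=j'$; - a regular antimatching if: $u^jv^{j'}\in E(G)$ iff $j\neq j'$; - a regular crossing if: $u^jv^{j'}\in E(G)$ iff $j+j'\geq k+1$; - an expanding matching if: $u^jv^{j'}\in E(G)$ iff $j'=2j$ or $j'=2j+1$; - an expanding antimatching if: $u^jv^{j'}\in E(G)$ iff $j'\neq 2j$ and $j'\neq 2j+1$; - an expanding crossing if: $u^jv^{j'}\in E(G)$ iff $2j+j'\geq 2k+2$; - (when $k\equiv 2 \pmod 4$) a skew expanding matching if, for all $j'$: for $1\le j\le (k-2)/4$, $u^jv^{j'}\in E(G)$ iff $j'\in\{2j,2j+1\}$; for $(k-2)/4< j\le (3k+2)/4$, $u^jv^{j'}\notin E(G)$; for $(3k+2)/4<j\le k$, $u^jv^{j'}\in E(G)$ iff $j'\in\{2j-k-2,2j-k-1\}$; - (when $k\equiv 2\pmod 4$) a skew expanding antimatching: as the skew expanding matching except that for $(k-2)/4< j\le (3k+2)/4$, $u^jv^{j'}\in E(G)$ for all $j'$; - (when $k\equiv 2\pmod 4$) a skew expanding crossing if, for all $j'$: for $1\le j\le (k-2)/4$, $u^jv^{j'}\in E(G)$ iff $2j+j'\geq k$; for $(k-2)/4<j\le k/2$, iff $j'\geq k/2+1$; for $k/2<j\le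 (3k+2)/4$, iff $j'\geq k/2-1$; for $(3k+2)/4<j\le k$, iff $2j+j'-2\geq 2k$. Regular/expanding/skew expanding triples are those of the respective three kinds; crossings are cross triples, matchings and antimatchings are parallel triples. A carousel on $n\geq 3$ sets of cardinality $k$: $V(G)=X_1\cup\dots\cup X_n$ disjoint, $X_i=\{x_i^1,\dots,x_i^k\}$ ordered, $(G,X_1,X_2)$ a regular crossing, $(G,X_i,X_{i+1})$ regular for $2\le i\le n-1$, $(G,X_n,X_1)$ expanding or skew expanding; other edges arbitrary. An even carousel of order $s$: $k=2^s-1$, an even number of cross triples among $(G,X_i,X_{i+1})$, $i=1,\dots,n$ (indices mod $n$), and $(G,X_n,X_1)$ expanding. An odd carousel of order $s$: $k=2(2^s-1)$, an odd number of such cross triples, and $(G,X_n,X_1)$ skew expanding. For disjoint $Y,Z\subseteq V(G)$, $\mathrm{rk}_G(Y,Z)$ is the $\mathrm{GF}(2)$-rank of the 0-1 adjacency matrix with rows $Y$ and columns $Z$. For $i\in\{1,\dots,n\}$ and $j\in\{1,\dots,s\}$, $X_{i,j}=\{x_i^{2^{j-1}},\dots,x_i^{2^j-1}\}$ and $\overline{X}_{i,j}=\{x_i^{k-a+1} : x_i^a\in X_{i,j}\}$. For an integer $m\ge 0$, a set $S\subseteq V(G)$ has label $Y_m$ if $(m-1)r<|S\cap Y|\le mr$ (so label $Y_0$ means $S\subseteq Z$). -}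

module Defs where

open import Data.Nat.Base using (ℕ; zero; suc; _+_; _*_; _∸_; _^_; _≤_; _<_; _≡ᵇ_; _≤ᵇ_)
open import Data.Nat.DivMod using (_/_)
open import Data.Nat.Divisibility using (_∣_)
open import Data.Bool.Base using (Bool; true; false; not; _∧_; _∨_; _xor_; if_then_else_)
open import Data.Fin.Base using (Fin; toℕ)
import Data.Fin.Base as Fin
open import Data.Product.Base using (Σ; ∃; _×_; _,_)
open import Data.Sum.Base using (_⊎_)
open import Relation.Binary.PropositionalEquality using (_≡_)
open import Relation.Nullary.Negation using (¬_)

-- Vertices of a carousel on n sets of cardinality k:
-- (i , a) is the paper's x_{toℕ i + 1}^{toℕ a + 1}; the sets X_i are disjoint
-- and cover V(G).
Vtx : ℕ → ℕ → Set
Vtx n k = Fin n × Fin k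

pos : ∀ {k} → Fin k → ℕ
pos a = suc (toℕ a)

record Graph (n k : ℕ) : Set where
  field
    adj    : Vtx n k → Vtx n k → Bool
    sym    : ∀ u v → adj u v ≡ adj v u
    irrefl : ∀ v → adj v v ≡ false
open Graph public

data Kind : Set where
  matching antimatching crossing : Kind

-- edge u^j v^{j'} of a regular triple of the given kind (j, j' 1-based)
regCond : ℕ → Kind → ℕ → ℕ → Bool
regCond k matching     j j' = j ≡ᵇ j'
regCond k antimatching j j' = not (j ≡ᵇ j')
regCond k crossing     j j' = suc k ≤ᵇ (j + j')

expCond : ℕ → Kind → ℕ → ℕ → Bool
expCond k matching     j j' = (j' ≡ᵇ 2 * j) ∨ (j' ≡ᵇ suc (2 * j))
expCond k antimatching j j' = not ((j' ≡ᵇ 2 * j) ∨ (j' ≡ᵇ suc (2 * j)))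
expCond k crossing     j j' = (2 * k + 2) ≤ᵇ (2 * j + j')

-- skew expanding triples (only used when k ≡ 2 mod 4, where the divisions are exact)
skewCond : ℕ → Kind → ℕ → ℕ → Bool
skewCond k matching j j' =
  if j ≤ᵇ ((k ∸ 2) / 4) then ((j' ≡ᵇ 2 * j) ∨ (j' ≡ᵇ suc (2 * j)))
  else if j ≤ᵇ ((3 * k + 2) / 4) then false
  else ((j' ≡ᵇ (2 * j ∸ k ∸ 2)) ∨ (j' ≡ᵇ (2 * j ∸ k ∸ 1)))
skewCond k antimatching j j' =
  if j ≤ᵇ ((k ∸ 2) / 4) then ((j' ≡ᵇ 2 * j) ∨ (j' ≡ᵇ suc (2 * j)))
  else if j ≤ᵇ ((3 * k + 2) / 4) then true
  else ((j' ≡ᵇ (2 * j ∸ k ∸ 2)) ∨ (j' ≡ᵇ (2 * j ∸ k ∸ 1)))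
skewCond k crossing j j' =
  if j ≤ᵇ ((k ∸ 2) / 4) then (k ≤ᵇ (2 * j + j'))
  else if j ≤ᵇ (k / 2) then (suc (k / 2) ≤ᵇ j')
  else if j ≤ᵇ ((3 * k + 2) / 4) then ((k / 2 ∸ 1) ≤ᵇ j')
  else ((2 * k + 2) ≤ᵇ (2 * j + j'))

TripleBy : ∀ {n k} → Graph n k → (ℕ → ℕ → Bool) → Fin n → Fin n → Set
TripleBy {n} {k} G cond i i' = ∀ (a b : Fin k) → adj G (i , a) (i' , b) ≡ cond (pos a) (pos b)

RegularTriple : ∀ {n k} → Graph n k → Kind → Fin n → Fin n → Set
RegularTriple {k = k} G t = TripleBy G (regCond k t)

ExpandingTriple : ∀ {n k} → Graph n k → Kind → Fin n → Fin n → Set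
ExpandingTriple {k = k} G t = TripleBy G (expCond k t)

SkewExpandingTriple : ∀ {n k} → Graph n k → Kind → Fin n → Fin n → Set
SkewExpandingTriple {k = k} G t i i' = k ≡ 2 + 4 * (k / 4) × TripleBy G (skewCond k t) i i'

isCross : Kind → Bool
isCross crossing = true
isCross _        = false

sumFin : ∀ {n} → (Fin n → ℕ) → ℕ
sumFin {zero}  f = 0
sumFin {suc n} f = f Fin.zero + sumFin (λ i → f (Fin.suc i))

crossCount : ∀ {n} → (Fin n → Kind) → ℕ
crossCount ty = sumFin (λ i → if isCross (ty i) then 1 else 0)

-- Carousel with triple kinds ty (ty i is the kind of (G, X_{i+1}, X_{i+2}) in
-- 0-based i; indices mod n); skew = true iff (G,X_n,X_1) is skew expanding.
record IsCarousel {n k : ℕ} (G : Graph n k) (ty : Fin n → Kind) (skew : Bool) : Set where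
  field
    first  : ∀ (i i' : Fin n) → toℕ i ≡ 0 → toℕ i' ≡ 1 →
               ty i ≡ crossing × RegularTriple G crossing i i'
    middle : ∀ (i i' : Fin n) → 1 ≤ toℕ i → toℕ i' ≡ suc (toℕ i) →
               RegularTriple G (ty i) i i'
    last   : ∀ (i i' : Fin n) → suc (toℕ i) ≡ n → toℕ i' ≡ 0 →
               (if skew then SkewExpandingTriple G (ty i) i i'
                        else ExpandingTriple G (ty i) i i')

EvenCarousel : ∀ {n k} → Graph n k → ℕ → Set
EvenCarousel {n} {k} G s =
  k ≡ 2 ^ s ∸ 1 × Σ (Fin n → Kind) (λ ty → IsCarousel G ty false × 2 ∣ crossCount ty)

OddCarousel : ∀ {n k} → Graph n k → ℕ → Set
OddCarousel {n} {k} G s =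
  k ≡ 2 * (2 ^ s ∸ 1) × Σ (Fin n → Kind) (λ ty → IsCarousel G ty true × ¬ (2 ∣ crossCount ty))

-- GF(2) rank of the Y × Z adjacency matrix, Z = complement of Y.
xorSum : ∀ {r} → (Fin r → Bool) → Bool
xorSum {zero}  f = false
xorSum {suc r} f = f Fin.zero xor xorSum (λ t → f (Fin.suc t))

-- r rows (vertices of Y) that are linearly independent over GF(2) as rows of
-- the matrix with rows Y and columns Z
IndepRows : ∀ {n k} → Graph n k → (Vtx n k → Bool) → (r : ℕ) → (Fin r → Vtx n k) → Set
IndepRows {n} {k} G Y r rows =
  (∀ t → Y (rows t) ≡ true) ×
  (∀ (c : Fin r → Bool) → (∃ λ t → c t ≡ true) →
     ∃ λ (z : Vtx n k) → Y z ≡ false × xorSum (λ t → c t ∧ adj G (rows t) z) ≡ true)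

-- rk_G(Y,Z) < r  (rank = maximum number of linearly independent rows)
RankLess : ∀ {n k} → Graph n k → (Vtx n k → Bool) → ℕ → Set
RankLess {n} {k} G Y r = ¬ (Σ (Fin r → Vtx n k) (IndepRows G Y r))

-- |X_{i,j} ∩ Y|, X_{i,j} = {x_i^a : 2^(j-1) ≤ a ≤ 2^j - 1}
inRange : ℕ → ℕ → Bool
inRange j a = (2 ^ (j ∸ 1) ≤ᵇ a) ∧ (a ≤ᵇ (2 ^ j ∸ 1))

countX : ∀ {n k} → (Vtx n k → Bool) → Fin n → ℕ → ℕ
countX {n} {k} Y i j = sumFin (λ (a : Fin k) → if inRange j (pos a) ∧ Y (i , a) then 1 else 0)

-- |X̄_{i,j} ∩ Y|, X̄_{i,j} = {x_i^{k-a+1} : x_i^a ∈ X_{i,j}}, i.e. x_i^b with k+1-b in range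
countXbar : ∀ {n k} → (Vtx n k → Bool) → Fin n → ℕ → ℕ
countXbar {n} {k} Y i j = sumFin (λ (b : Fin k) → if inRange j (suc k ∸ pos b) ∧ Y (i , b) then 1 else 0)

-- a set S with c = |S ∩ Y| has label Y_m : (m-1) r < c ≤ m r
HasLabel : ℕ → ℕ → ℕ → Set
HasLabel r c m = c ≤ m * r × (m ≡ 0 ⊎ (m ∸ 1) * r < c)

NearLabel : ℕ → ℕ → ℕ → Set
NearLabel r c m = HasLabel r c (m ∸ 1) ⊎ HasLabel r c m ⊎ HasLabel r c (suc m)

RegularParallel : ∀ {n k} → Graph n k → Fin n → Fin n → Set
RegularParallel G i i' = RegularTriple G matching i i' ⊎ RegularTriple G antimatching i i'

module Submission where

open import Defs renaming (sym to adj-sym)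
open import Data.Nat.Base using (ℕ; zero; suc; _+_; _*_; _∸_; _≤_; _<_; _≤ᵇ_; _≡ᵇ_; z≤n; s≤s; s≤s⁻¹)
open import Data.Nat.Properties
  using (≤-refl; ≤-trans; ≤-reflexive; <-irrefl; <⇒≤; ≰⇒>; <⇒≱; ≤∧≢⇒<; <-≤-trans;
         +-mono-≤; +-monoˡ-≤; +-monoʳ-≤; +-monoˡ-<; +-cancelˡ-<; +-comm; +-assoc; +-identityʳ; +-∸-assoc; ∸-monoʳ-≤;
         m+[n∸m]≡n; m∸[m∸n]≡n; +-commutativeSemigroup; _≤?_)
  renaming (_≟_ to _≟ℕ_; suc-injective to ℕ-suc-injective)
open import Data.Fin.Base using (Fin; toℕ; opposite; inject₁; fromℕ)
import Data.Fin.Base as Fin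
open import Data.Fin.Properties
  using (_≟_; 0≢1+n; toℕ-injective; toℕ<n; opposite-prop; opposite-involutive; suc-injective)
open import Data.Bool.Base using (Bool; true; false; not; _∧_; _xor_; if_then_else_)
open import Data.Bool.Properties using (∧-identityʳ; not-distribˡ-xor; not-distribʳ-xor)
open import Data.Product.Base using (Σ; ∃; _×_; _,_; proj₁; proj₂)
open import Data.Sum.Base using (_⊎_; inj₁; inj₂)
open import Function.Base using (_∘_)
open import Function.Definitions using (Injective)
open import Relation.Nullary.Negation using (contradiction)
open import Relation.Nullary.Decidable using (Dec; yes; no; does; dec-true; dec-false)
open import Relation.Binary.PropositionalEquality
  using (_≡_; _≢_; refl; sym; trans; cong; cong₂; subst; subst₂; module ≡-Reasoning)
open import Algebra.Properties.CommutativeSemigroup +-commutativeSemigroup using (interchange)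

-- Call a ∈ X_{i,j} split if x_i^a ∈ Y while its partner in X_{i'} (x_{i'}^a for a parallel
-- triple, x_{i'}^{k+1-a} for a crossing) lies in Z. The rows of split vertices in the Y × Z
-- matrix contain an identity, a triangular (half graph) or an identity-complement submatrix
-- on the partners, of GF(2)-rank at least the number of split vertices (minus one for the
-- complement). So at most r vertices split in either direction, the two counts differ by at
-- most r, and the label moves by at most one.

count : ∀ {p} → (Fin p → Bool) → ℕ
count P = sumFin (λ a → if P a then 1 else 0)

sumFin-cong : ∀ {p} {f g : Fin p → ℕ} → (∀ a → f a ≡ g a) → sumFin f ≡ sumFin g
sumFin-cong {zero}  f≡g = refl
sumFin-cong {suc p} f≡g = cong₂ _+_ (f≡g Fin.zero) (sumFin-cong (f≡g ∘ Fin.suc))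

sumFin-mono : ∀ {p} {f g : Fin p → ℕ} → (∀ a → f a ≤ g a) → sumFin f ≤ sumFin g
sumFin-mono {zero}  f≤g = z≤n
sumFin-mono {suc p} f≤g = +-mono-≤ (f≤g Fin.zero) (sumFin-mono (f≤g ∘ Fin.suc))

sumFin-+ : ∀ {p} (f g : Fin p → ℕ) → sumFin (λ a → f a + g a) ≡ sumFin f + sumFin g
sumFin-+ {zero}  f g = refl
sumFin-+ {suc p} f g =
  trans (cong (f Fin.zero + g Fin.zero +_) (sumFin-+ (f ∘ Fin.suc) (g ∘ Fin.suc)))
        (interchange (f Fin.zero) (g Fin.zero) _ _)

sumFin-last : ∀ {p} (f : Fin (suc p) → ℕ) → sumFin f ≡ sumFin (f ∘ inject₁) + f (fromℕ p)
sumFin-last {zero}  f = +-comm (f Fin.zero) 0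
sumFin-last {suc p} f =
  trans (cong (f Fin.zero +_) (sumFin-last (f ∘ Fin.suc)))
        (sym (+-assoc (f Fin.zero) _ _))

sumFin-opposite : ∀ {p} (f : Fin p → ℕ) → sumFin (f ∘ opposite) ≡ sumFin f
sumFin-opposite {zero}  f = refl
sumFin-opposite {suc p} f = begin
  f (fromℕ p) + sumFin (f ∘ inject₁ ∘ opposite) ≡⟨ cong (f (fromℕ p) +_) (sumFin-opposite (f ∘ inject₁)) ⟩
  f (fromℕ p) + sumFin (f ∘ inject₁)            ≡⟨ +-comm (f (fromℕ p)) _ ⟩
  sumFin (f ∘ inject₁) + f (fromℕ p)            ≡⟨ sym (sumFin-last f) ⟩
  sumFin f                                      ∎
  where open ≡-Reasoning

count-cong : ∀ {p} {P Q : Fin p → Bool} → (∀ a → P a ≡ Q a) → count P ≡ count Q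
count-cong P≡Q = sumFin-cong (λ a → cong (λ b → if b then 1 else 0) (P≡Q a))

count-opposite : ∀ {p} (P : Fin p → Bool) → count P ≡ count (P ∘ opposite)
count-opposite P = sym (sumFin-opposite (λ a → if P a then 1 else 0))

count-∧-≤ : ∀ {p} (P Q Q′ : Fin p → Bool) →
  count (λ a → P a ∧ Q a) ≤ count (λ a → P a ∧ Q′ a) + count (λ a → P a ∧ Q a ∧ not (Q′ a))
count-∧-≤ P Q Q′ =
  ≤-trans (sumFin-mono (λ a → indicator-≤ (P a) (Q a) (Q′ a)))
          (≤-reflexive (sumFin-+ (λ a → if P a ∧ Q′ a then 1 else 0)
                                 (λ a → if P a ∧ Q a ∧ not (Q′ a) then 1 else 0)))
  where
  indicator-≤ : ∀ x y z →
    (if x ∧ y then 1 else 0) ≤ (if x ∧ z then 1 else 0) + (if x ∧ y ∧ not z then 1 else 0)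
  indicator-≤ true  true  true  = s≤s z≤n
  indicator-≤ true  true  false = s≤s z≤n
  indicator-≤ true  false z     = z≤n
  indicator-≤ false y     z     = z≤n

select : ∀ {p} (P : Fin p → Bool) (m : ℕ) → m ≤ count P →
  Σ (Fin m → Fin p) λ e → Injective _≡_ _≡_ e × (∀ t → P (e t) ≡ true)
select P zero _ = (λ ()) , (λ { {()} }) , (λ ())
select {zero} P (suc m) ()
select {suc p} P (suc m) m≤count with P Fin.zero in P0
... | true =
  let e , e-inj , inP = select (P ∘ Fin.suc) m (s≤s⁻¹ m≤count) in
  (λ { Fin.zero → Fin.zero ; (Fin.suc t) → Fin.suc (e t) }) ,
  (λ { {Fin.zero} {Fin.zero} _ → refl
     ; {Fin.suc t} {Fin.suc t′} eq → cong Fin.suc (e-inj (suc-injective eq)) }) ,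
  (λ { Fin.zero → P0 ; (Fin.suc t) → inP t })
... | false =
  let e , e-inj , inP = select (P ∘ Fin.suc) (suc m) m≤count in
  Fin.suc ∘ e , e-inj ∘ suc-injective , inP

argmax⊎all-false : ∀ {r} (c : Fin r → Bool) (w : Fin r → ℕ) →
  (Σ (Fin r) λ t* → c t* ≡ true × (∀ t → c t ≡ true → w t ≤ w t*)) ⊎ (∀ t → c t ≡ false)
argmax⊎all-false {zero} c w = inj₂ (λ ())
argmax⊎all-false {suc r} c w with argmax⊎all-false (c ∘ Fin.suc) (w ∘ Fin.suc) | c Fin.zero in c0
... | inj₂ none | false = inj₂ λ { Fin.zero → c0 ; (Fin.suc t) → none t }
... | inj₂ none | true  = inj₁ (Fin.zero , c0 , λ
  { Fin.zero _ → ≤-refl ; (Fin.suc t) ct → contradiction (trans (sym (none t)) ct) λ () })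
... | inj₁ (t* , ct* , max) | false = inj₁ (Fin.suc t* , ct* , λ
  { Fin.zero ct → contradiction (trans (sym c0) ct) λ () ; (Fin.suc t) ct → max t ct })
... | inj₁ (t* , ct* , max) | true with w Fin.zero ≤? w (Fin.suc t*)
...   | yes w0≤ = inj₁ (Fin.suc t* , ct* , λ { Fin.zero _ → w0≤ ; (Fin.suc t) ct → max t ct })
...   | no w0≰ = inj₁ (Fin.zero , c0 , λ
  { Fin.zero _ → ≤-refl ; (Fin.suc t) ct → ≤-trans (max t ct) (<⇒≤ (≰⇒> w0≰)) })

xorSum-cong : ∀ {r} {f g : Fin r → Bool} → (∀ t → f t ≡ g t) → xorSum f ≡ xorSum g
xorSum-cong {zero}  f≡g = refl
xorSum-cong {suc r} f≡g = cong₂ _xor_ (f≡g Fin.zero) (xorSum-cong (f≡g ∘ Fin.suc))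

xorSum-false : ∀ r → xorSum {r} (λ _ → false) ≡ false
xorSum-false zero    = refl
xorSum-false (suc r) = xorSum-false r

xorSum-flip : ∀ {r} (f g : Fin r → Bool) (t₀ : Fin r) →
  (∀ t → t ≢ t₀ → f t ≡ g t) → f t₀ ≡ not (g t₀) → xorSum f ≡ not (xorSum g)
xorSum-flip {suc r} f g Fin.zero same flipped =
  trans (cong₂ _xor_ flipped (xorSum-cong (λ t → same (Fin.suc t) λ ())))
        (sym (not-distribˡ-xor (g Fin.zero) _))
xorSum-flip {suc r} f g (Fin.suc t₀) same flipped =
  trans (cong₂ _xor_ (same Fin.zero λ ())
                     (xorSum-flip (f ∘ Fin.suc) (g ∘ Fin.suc) t₀
                        (λ t t≢t₀ → same (Fin.suc t) (t≢t₀ ∘ suc-injective)) flipped))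
        (sym (not-distribʳ-xor (g Fin.zero) _))

splitCount : ∀ {n k p} → (Vtx n k → Bool) → (Fin p → Bool) → (u v : Fin p → Vtx n k) → ℕ
splitCount Y R u v = count (λ a → R a ∧ Y (u a) ∧ not (Y (v a)))

∧-∧-not≡true : ∀ x y z → x ∧ y ∧ not z ≡ true → y ≡ true × z ≡ false
∧-∧-not≡true true true false _ = refl , refl

module _ {n k p : ℕ} (G : Graph n k) (Y : Vtx n k → Bool) (u v : Fin p → Vtx n k) where

  Separates : ∀ {r} → (Fin r → Fin p) → Set
  Separates e = ∀ t → Y (u (e t)) ≡ true × Y (v (e t)) ≡ false

  triangular-independent : (w : Fin p → ℕ) → Injective _≡_ _≡_ w →
    (∀ a → adj G (u a) (v a) ≡ true) → (∀ a b → w a < w b → adj G (u a) (v b) ≡ false) →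
    ∀ {r} (e : Fin r → Fin p) → Injective _≡_ _≡_ e → Separates e → IndepRows G Y r (u ∘ e)
  triangular-independent w w-inj diag upper {r} e e-inj sep = proj₁ ∘ sep , independent
    where
    independent : ∀ c → ∃ (λ t → c t ≡ true) →
      ∃ λ z → Y z ≡ false × xorSum (λ t → c t ∧ adj G (u (e t)) z) ≡ true
    -- the row of largest weight in the combination is the only one meeting its own column
    independent c (t₀ , ct₀) with argmax⊎all-false c (w ∘ e)
    ... | inj₂ none = contradiction (trans (sym (none t₀)) ct₀) λ ()
    ... | inj₁ (t* , ct* , max) = v (e t*) , proj₂ (sep t*) ,
          trans (xorSum-flip _ (λ _ → false) t* below top) (cong not (xorSum-false r))
      where
      top : c t* ∧ adj G (u (e t*)) (v (e t*)) ≡ true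
      top rewrite ct* | diag (e t*) = refl
      below : ∀ t → t ≢ t* → c t ∧ adj G (u (e t)) (v (e t*)) ≡ false
      below t t≢t* with c t in ct
      ... | false = refl
      ... | true  = upper (e t) (e t*) (≤∧≢⇒< (max t ct) (t≢t* ∘ e-inj ∘ w-inj))

  antidiagonal-independent :
    (∀ a → adj G (u a) (v a) ≡ false) → (∀ a b → a ≢ b → adj G (u a) (v b) ≡ true) →
    ∀ {r} (e : Fin (suc r) → Fin p) → Injective _≡_ _≡_ e → Separates e →
    IndepRows G Y r (u ∘ e ∘ Fin.suc)
  antidiagonal-independent diag off e e-inj sep = proj₁ ∘ sep ∘ Fin.suc , independent
    where
    independent : ∀ c → ∃ (λ t → c t ≡ true) →
      ∃ λ z → Y z ≡ false × xorSum (λ t → c t ∧ adj G (u (e (Fin.suc t))) z) ≡ true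
    -- an odd combination is seen by the column of the unused row e 0, which meets every row;
    -- an even one by the column of one of its rows, which meets all rows but that one
    independent c (t₀ , ct₀) with xorSum c in parity
    ... | true = v (e Fin.zero) , proj₂ (sep Fin.zero) ,
          trans (xorSum-cong λ t → trans (cong (c t ∧_) (off _ _ (0≢1+n ∘ sym ∘ e-inj)))
                                         (∧-identityʳ (c t)))
                parity
    ... | false = v (e (Fin.suc t₀)) , proj₂ (sep (Fin.suc t₀)) ,
          trans (xorSum-flip _ c t₀ same flipped) (cong not parity)
      where
      same : ∀ t → t ≢ t₀ → c t ∧ adj G (u (e (Fin.suc t))) (v (e (Fin.suc t₀))) ≡ c t
      same t t≢t₀ =
        trans (cong (c t ∧_) (off _ _ (t≢t₀ ∘ suc-injective ∘ e-inj))) (∧-identityʳ (c t))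
      flipped : c t₀ ∧ adj G (u (e (Fin.suc t₀))) (v (e (Fin.suc t₀))) ≡ not (c t₀)
      flipped rewrite ct₀ | diag (e (Fin.suc t₀)) = refl

  splitCount<-triangular : ∀ {r} → RankLess G Y r → (w : Fin p → ℕ) → Injective _≡_ _≡_ w →
    (∀ a → adj G (u a) (v a) ≡ true) → (∀ a b → w a < w b → adj G (u a) (v b) ≡ false) →
    ∀ R → splitCount Y R u v < r
  splitCount<-triangular {r} rk w w-inj diag upper R = ≰⇒> λ r≤split →
    let e , e-inj , inR = select _ r r≤split in
    rk (u ∘ e , triangular-independent w w-inj diag upper e e-inj
                  (λ t → ∧-∧-not≡true (R (e t)) _ _ (inR t)))

  splitCount≤-antidiagonal : ∀ {r} → RankLess G Y r →
    (∀ a → adj G (u a) (v a) ≡ false) → (∀ a b → a ≢ b → adj G (u a) (v b) ≡ true) →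
    ∀ R → splitCount Y R u v ≤ r
  splitCount≤-antidiagonal {r} rk diag off R = s≤s⁻¹ (≰⇒> λ r<split →
    let e , e-inj , inR = select _ (suc r) r<split in
    rk (u ∘ e ∘ Fin.suc , antidiagonal-independent diag off e e-inj
                            (λ t → ∧-∧-not≡true (R (e t)) _ _ (inR t))))

near-label : ∀ r c c′ m → c ≤ c′ + r → c′ ≤ c + r → HasLabel r c m → NearLabel r c′ m
near-label r c c′ zero c≤ c′≤ (c≤0 , _) with c′ ≤? 0
... | yes c′≤0 = inj₁ (c′≤0 , inj₁ refl)
... | no  c′≰0 = inj₂ (inj₂ (c′≤r , inj₂ (≰⇒> c′≰0)))
  where
  c′≤r : c′ ≤ r + 0
  c′≤r = ≤-trans c′≤ (≤-trans (+-monoˡ-≤ r c≤0) (≤-reflexive (sym (+-identityʳ r))))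
near-label r c c′ (suc m) c≤ c′≤ (c≤[1+m]r , inj₂ mr<c) with c′ ≤? m * r
... | yes c′≤mr = inj₁ (c′≤mr , below m mr<c)
  where
  below : ∀ m → m * r < c → m ≡ 0 ⊎ (m ∸ 1) * r < c′
  below zero      _    = inj₁ refl
  below (suc m′) [1+m′]r<c =
    inj₂ (+-cancelˡ-< r (m′ * r) c′ (<-≤-trans [1+m′]r<c (≤-trans c≤ (≤-reflexive (+-comm c′ r)))))
... | no c′≰mr with c′ ≤? suc m * r
...   | yes c′≤[1+m]r = inj₂ (inj₁ (c′≤[1+m]r , inj₂ (≰⇒> c′≰mr)))
...   | no  c′≰[1+m]r = inj₂ (inj₂ (c′≤[2+m]r , inj₂ (≰⇒> c′≰[1+m]r)))
  where
  c′≤[2+m]r : c′ ≤ r + suc m * r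
  c′≤[2+m]r = ≤-trans c′≤ (≤-trans (+-monoˡ-≤ r c≤[1+m]r) (≤-reflexive (+-comm (suc m * r) r)))

SplitBounded : ∀ {n k p} → (Vtx n k → Bool) → ℕ → (u v : Fin p → Vtx n k) → Set
SplitBounded Y r u v = ∀ R → splitCount Y R u v ≤ r × splitCount Y R v u ≤ r

near-label-transfer : ∀ {n k p} (Y : Vtx n k → Bool) {r} (u v : Fin p → Vtx n k) →
  SplitBounded Y r u v → ∀ R m →
  HasLabel r (count (λ a → R a ∧ Y (u a))) m → NearLabel r (count (λ a → R a ∧ Y (v a))) m
near-label-transfer Y {r} u v bounded R m = near-label r _ _ m
  (≤-trans (count-∧-≤ R (Y ∘ u) (Y ∘ v)) (+-monoʳ-≤ _ (proj₁ (bounded R))))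
  (≤-trans (count-∧-≤ R (Y ∘ v) (Y ∘ u)) (+-monoʳ-≤ _ (proj₂ (bounded R))))

toℕ∘opposite-injective : ∀ {p} → Injective _≡_ _≡_ (toℕ ∘ opposite {p})
toℕ∘opposite-injective {x = a} {b} eq =
  trans (sym (opposite-involutive a)) (trans (cong opposite (toℕ-injective eq)) (opposite-involutive b))

opposite-reverses-< : ∀ {p} {a b : Fin p} → toℕ (opposite a) < toℕ (opposite b) → toℕ b < toℕ a
opposite-reverses-< {p} {a} {b} lt = ≰⇒> λ a≤b →
  <⇒≱ lt (subst₂ _≤_ (sym (opposite-prop b)) (sym (opposite-prop a)) (∸-monoʳ-≤ p (s≤s a≤b)))

MatchingBetween AntimatchingBetween HalfGraphBetween :
  ∀ {n k p} → Graph n k → (u v : Fin p → Vtx n k) → Set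
MatchingBetween     G u v = ∀ a b → adj G (u a) (v b) ≡ does (a ≟ b)
AntimatchingBetween G u v = ∀ a b → adj G (u a) (v b) ≡ not (does (a ≟ b))
HalfGraphBetween    G u v = ∀ a b → adj G (u a) (v b) ≡ (toℕ b ≤ᵇ toℕ a)

does-≟-comm : ∀ {p} (a b : Fin p) → does (b ≟ a) ≡ does (a ≟ b)
does-≟-comm a b with a ≟ b
... | yes refl = dec-true (a ≟ a) refl
... | no  a≢b  = dec-false (b ≟ a) (a≢b ∘ sym)

module _ {n k p : ℕ} (G : Graph n k) where

  matching-transpose : {u v : Fin p → Vtx n k} → MatchingBetween G u v → MatchingBetween G v u
  matching-transpose matched a b =
    trans (adj-sym G _ _) (trans (matched b a) (does-≟-comm a b))

  antimatching-transpose : {u v : Fin p → Vtx n k} →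
    AntimatchingBetween G u v → AntimatchingBetween G v u
  antimatching-transpose antimatched a b =
    trans (adj-sym G _ _) (trans (antimatched b a) (cong not (does-≟-comm a b)))

  module _ (Y : Vtx n k → Bool) {r : ℕ} (rk : RankLess G Y r) where

    matching-splitCount< : {u v : Fin p → Vtx n k} →
      MatchingBetween G u v → ∀ R → splitCount Y R u v < r
    matching-splitCount< {u} {v} matched = splitCount<-triangular G Y u v rk toℕ toℕ-injective
      (λ a → trans (matched a a) (dec-true (a ≟ a) refl))
      (λ a b a<b → trans (matched a b) (dec-false (a ≟ b) λ { refl → <-irrefl refl a<b }))

    matching-splitBounded : {u v : Fin p → Vtx n k} →
      MatchingBetween G u v → SplitBounded Y r u v
    matching-splitBounded matched R =
      <⇒≤ (matching-splitCount< matched R) ,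
      <⇒≤ (matching-splitCount< (matching-transpose matched) R)

    antimatching-splitBounded : {u v : Fin p → Vtx n k} →
      AntimatchingBetween G u v → SplitBounded Y r u v
    antimatching-splitBounded antimatched R =
      splitCount≤ antimatched , splitCount≤ (antimatching-transpose antimatched)
      where
      splitCount≤ : {u v : Fin p → Vtx n k} → AntimatchingBetween G u v → splitCount Y R u v ≤ r
      splitCount≤ {u} {v} anti = splitCount≤-antidiagonal G Y u v rk
        (λ a → trans (anti a a) (cong not (dec-true (a ≟ a) refl)))
        (λ a b a≢b → trans (anti a b) (cong not (dec-false (a ≟ b) a≢b)))
        R

    halfGraph-splitBounded : {u v : Fin p → Vtx n k} →
      HalfGraphBetween G u v → SplitBounded Y r u v
    halfGraph-splitBounded {u} {v} half R =
      <⇒≤ (splitCount<-triangular G Y u v rk toℕ toℕ-injective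
             (λ a → trans (half a a) (dec-true (toℕ a ≤? toℕ a) ≤-refl))
             (λ a b a<b → trans (half a b) (dec-false (toℕ b ≤? toℕ a) (<⇒≱ a<b)))
             R) ,
      <⇒≤ (splitCount<-triangular G Y v u rk (toℕ ∘ opposite) toℕ∘opposite-injective
             (λ a → trans (adj-sym G _ _) (trans (half a a) (dec-true (toℕ a ≤? toℕ a) ≤-refl)))
             (λ a b lt → trans (adj-sym G _ _)
                           (trans (half b a) (dec-false (toℕ a ≤? toℕ b) (<⇒≱ (opposite-reverses-< lt)))))
             R)

pos-≡ᵇ : ∀ {k} (a b : Fin k) → (pos a ≡ᵇ pos b) ≡ does (a ≟ b)
pos-≡ᵇ a b with a ≟ b
... | yes refl = dec-true (pos a ≟ℕ pos a) refl
... | no  a≢b  = dec-false (pos a ≟ℕ pos b) (a≢b ∘ toℕ-injective ∘ ℕ-suc-injective)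

pos-opposite : ∀ {k} (a : Fin k) → pos (opposite a) ≡ suc k ∸ pos a
pos-opposite a = trans (cong suc (opposite-prop a)) (sym (+-∸-assoc 1 (toℕ<n a)))

crossing-opposite : ∀ {k} (a b : Fin k) → (suc k ≤ᵇ (pos a + pos (opposite b))) ≡ (toℕ b ≤ᵇ toℕ a)
crossing-opposite {k} a b =
  trans (cong (λ x → suc k ≤ᵇ (pos a + x)) (pos-opposite b)) (decide (toℕ b ≤? toℕ a))
  where
  b≤k : toℕ b ≤ k
  b≤k = <⇒≤ (toℕ<n b)
  decide : (d : Dec (toℕ b ≤ toℕ a)) → (suc k ≤ᵇ suc (toℕ a + (k ∸ toℕ b))) ≡ does d
  decide (yes b≤a) = dec-true (suc k ≤? _)
    (s≤s (≤-trans (≤-reflexive (sym (m+[n∸m]≡n b≤k))) (+-monoˡ-≤ (k ∸ toℕ b) b≤a)))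
  decide (no  b≰a) = dec-false (suc k ≤? _) λ k<1+a+[k∸b] →
    <⇒≱ (<-≤-trans (+-monoˡ-< (k ∸ toℕ b) (≰⇒> b≰a)) (≤-reflexive (m+[n∸m]≡n b≤k))) (s≤s⁻¹ k<1+a+[k∸b])

module _ {n k : ℕ} (G : Graph n k) (Y : Vtx n k → Bool) {r : ℕ} (rk : RankLess G Y r)
         (i i′ : Fin n) where

  parallel-splitBounded : RegularParallel G i i′ → SplitBounded Y r (i ,_) (i′ ,_)
  parallel-splitBounded (inj₁ matched) =
    matching-splitBounded G Y rk λ a b → trans (matched a b) (pos-≡ᵇ a b)
  parallel-splitBounded (inj₂ antimatched) =
    antimatching-splitBounded G Y rk λ a b → trans (antimatched a b) (cong not (pos-≡ᵇ a b))

  crossing-splitBounded : RegularTriple G crossing i i′ →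
    SplitBounded Y r (i ,_) (λ a → i′ , opposite a)
  crossing-splitBounded crossed =
    halfGraph-splitBounded G Y rk λ a b → trans (crossed a (opposite b)) (crossing-opposite a b)

module _ {n k : ℕ} (Y : Vtx n k → Bool) (i : Fin n) (j : ℕ) where

  countX-opposite : countX Y i j ≡ count (λ a → inRange j (suc k ∸ pos a) ∧ Y (i , opposite a))
  countX-opposite = trans (count-opposite (λ a → inRange j (pos a) ∧ Y (i , a))) (count-cong λ a →
    cong (λ x → inRange j x ∧ Y (i , opposite a)) (pos-opposite a))

  countXbar-opposite : countXbar Y i j ≡ count (λ a → inRange j (pos a) ∧ Y (i , opposite a))
  countXbar-opposite = trans (count-opposite (λ a → inRange j (suc k ∸ pos a) ∧ Y (i , a))) (count-cong λ a →
    cong (λ x → inRange j x ∧ Y (i , opposite a))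
         (trans (cong (k ∸_) (opposite-prop a)) (m∸[m∸n]≡n (toℕ<n a))))

lemma7 : (n s r k : ℕ) → 3 ≤ n → 1 ≤ s → 2 ≤ r →
    (G : Graph n k) → EvenCarousel G s ⊎ OddCarousel G s →
    (Y : Vtx n k → Bool) → RankLess G Y r →
    (m : ℕ) (i i' : Fin n) → toℕ i' ≡ suc (toℕ i) →
    (j : ℕ) → 1 ≤ j → j ≤ s →
    (RegularParallel G i i' →
      (HasLabel r (countX Y i j) m → NearLabel r (countX Y i' j) m) ×
      (HasLabel r (countXbar Y i j) m → NearLabel r (countXbar Y i' j) m)) ×
    (RegularTriple G crossing i i' →
      (HasLabel r (countX Y i j) m → NearLabel r (countXbar Y i' j) m) ×
      (HasLabel r (countXbar Y i j) m → NearLabel r (countX Y i' j) m))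
lemma7 n s r k _ _ _ G _ Y rk m i i' _ j _ _ =
  (λ parallel → let bounded = parallel-splitBounded G Y rk i i' parallel in
     transfer (i' ,_) bounded X , transfer (i' ,_) bounded X̄) ,
  (λ crossed → let bounded = crossing-splitBounded G Y rk i i' crossed in
     subst (λ c → NearLabel r c m) (sym (countXbar-opposite Y i' j)) ∘ transfer opposite′ bounded X ,
     subst (λ c → NearLabel r c m) (sym (countX-opposite Y i' j)) ∘ transfer opposite′ bounded X̄)
  where
  X X̄ : Fin k → Bool
  X  a = inRange j (pos a)
  X̄ a = inRange j (suc k ∸ pos a)
  opposite′ : Fin k → Vtx n k
  opposite′ a = i' , opposite a
  transfer : (v : Fin k → Vtx n k) → SplitBounded Y r (i ,_) v → ∀ R →
    HasLabel r (count (λ a → R a ∧ Y (i , a))) m → NearLabel r (count (λ a → R a ∧ Y (v a))) m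
  transfer v bounded R = near-label-transfer Y (i ,_) v bounded R m
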